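{- Let $n\ge0$ and let $\gamma$ be a composition of $n$. Then \[ \blacktriangle\big(\kappa_{\mathrm{set}(\gamma)}(\nu)\big)=\sum_{\alpha\odot\beta=\gamma}\kappa_{\mathrm{set}(\alpha)}(\nu)\otimes\kappa_{\mathrm{set}(\beta)}(\nu), \] where the sum runs over pairs $(\alpha,\beta)$ of compositions (the empty composition allowed) with $\alpha\odot\beta=\gamma$, and $\kappa_{\mathrm{set}(\alpha)}(\nu)\in\mathrm{scf}(\mathcal N_{|\alpha|}(\nu))$.
   Context: Notation: $[a,b]=\{t\in\mathbb Z:a\le t\le b\}$, $[n]=[1,n]$. Fix $\nu>1$; $C_\nu$ additive cyclic group of order $\nu$; for a finite set $S$ of integers, $Q_S(\nu)=\bigoplus_{s\in S}C_\nu$, and for $T\subseteq S$, $Q_T(\nu)$ is the subgroup of tuples vanishing outside $T$; $Q_n(\nu)=Q_{[n-1]}(\nu)$ ($Q_0,Q_1$ trivial). $\kappa_I(\nu)$ ($I\subseteq[n-1]$) is the indicator function on $Q_n(\nu)$ of $\{\bm g:g_i\ne0\iff i\in I\}$; $\mathrm{scf}(\mathcal N_n(\nu))$ is the span of these (the superclass identifiers of the normal supercharacter theory given by $\{Q_I(\nu):I\subseteq[n-1]\}$). $\mathrm{cf}(G)$: functions on $G$. A composition $\alpha=(\alpha_1,\dots,\alpha_l)$ of $n$ has $\mathrm{set}(\alpha)=\{\alpha_1,\alpha_1+\alpha_2,\dots,\alpha_1+\dots+\alpha_{l-1}\}\subseteq[n-1]$; the near-concatenation is $(\alpha_1,\dots,\alpha_l)\odot(\beta_1,\dots,\beta_k)=(\alpha_1,\dots,\alpha_{l-1},\alpha_l+\beta_1,\beta_2,\dots,\beta_k)$,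 with $\emptyset\odot\beta=\beta$, $\alpha\odot\emptyset=\alpha$. Standardization: for $S=\{s_1<\dots<s_t\}$, $\iota_S:Q_S(\nu)\to Q_{t+1}(\nu)$, $(g_s)\mapsto(g_{s_i})_i$, $\iota_S^*\phi=\phi\circ\iota_S$. Coproduct: for $\phi\in\mathrm{cf}(Q_n(\nu))$, $\blacktriangle_0(\phi)=\mathbbm1_0\otimes\phi$, $\blacktriangle_n(\phi)=\phi\otimes\mathbbm1_0$ ($\mathbbm1_0$ the constant $1$ on $Q_0(\nu)$), and for $1\le k\le n-1$, $\blacktriangle_k(\phi)$ is the image of the restriction $\phi\downarrow_{Q_{[1,k-1]\cup[k+1,n-1]}(\nu)}$, viewed in $\mathrm{cf}(Q_{[1,k-1]}(\nu))\otimes\mathrm{cf}(Q_{[k+1,n-1]}(\nu))$ (via $f\otimes g\mapsto((a,b)\mapsto f(a)g(b))$), under $\mathrm{id}\otimes(\iota^*_{[k+1,n-1]})^{ -1}$, lying in $\mathrm{cf}(Q_k(\nu))\otimes\mathrm{cf}(Q_{n-k}(\nu))$; $\blacktriangle=\sum_{k=0}^n\blacktriangle_k$. -}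

module Defs where

open import Data.Nat using (ℕ; zero; suc; pred; _∸_; _<_; _≤_; _<?_; _≟_; NonZero)
import Data.Nat as ℕ
open import Data.Fin using (Fin; toℕ; fromℕ<)
import Data.Fin as F
open import Data.Integer using (ℤ; 0ℤ; 1ℤ) renaming (_+_ to _+ℤ_; _*_ to _*ℤ_)
open import Data.Bool using (Bool; true; false; if_then_else_; not; _xor_)
open import Data.List using (List; []; _∷_; map; foldr; filter; concatMap; upTo; cartesianProduct; allFin)
open import Data.Nat.ListAction using (sum)
open import Data.Bool.ListAction using (all; any)
open import Data.List.Relation.Unary.All using (All)
open import Data.List.Properties using (≡-dec)
open import Data.Product using (_×_; _,_; proj₁; proj₂)
open import Relation.Binary.PropositionalEquality using (_≡_)
import Relation.Nullary

IsComposition : ℕ → List ℕ → Set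
IsComposition n α = All (λ x → 0 < x) α × sum α ≡ n

listsOfLen : ℕ → ℕ → List (List ℕ)
listsOfLen zero    m = [] ∷ []
listsOfLen (suc l) m = concatMap (λ x → map (x ∷_) (listsOfLen l m)) (map suc (upTo m))

compositions : ℕ → List (List ℕ)
compositions m =
  filter (λ xs → sum xs ≟ m) (concatMap (λ l → listsOfLen l m) (upTo (suc m)))

-- set(α) = {α₁, α₁+α₂, …, α₁+…+α_{l-1}}  (as a list of naturals)
setC : List ℕ → List ℕ
setC []           = []
setC (a ∷ [])     = []
setC (a ∷ b ∷ xs) = a ∷ map (a ℕ.+_) (setC (b ∷ xs))

_⊙_ : List ℕ → List ℕ → List ℕ
[]           ⊙ β       = β
(a ∷ [])     ⊙ []      = a ∷ []
(a ∷ [])     ⊙ (b ∷ β) = (a ℕ.+ b) ∷ β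
(a ∷ a' ∷ α) ⊙ β       = a ∷ ((a' ∷ α) ⊙ β)

-- The groups Q_n(ν) = ⊕_{i ∈ [n-1]} C_ν, as tuples indexed by Fin (n-1);
-- the index i : Fin (pred n) stands for position suc (toℕ i) ∈ [1,n-1].
-- C_ν is modelled by Fin ν (addition mod ν; only the zero element matters here).

Q : ℕ → ℕ → Set
Q ν n = Fin (pred n) → Fin ν

-- class functions (ℤ-valued; all functions involved are integer-valued)
CF : ℕ → ℕ → Set
CF ν n = Q ν n → ℤ

zeroF : (ν : ℕ) → .{{NonZero ν}} → Fin ν
zeroF (suc ν) = F.zero

isNonzero : ∀ {ν} → Fin ν → Bool
isNonzero x = not (toℕ x ℕ.≡ᵇ 0)

eqB : Bool → Bool → Bool
eqB x y = not (x xor y)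

memb : ℕ → List ℕ → Bool
memb p I = any (λ q → p ℕ.≡ᵇ q) I

κ : ∀ {ν} (n : ℕ) → List ℕ → CF ν n
κ n I g = if all (λ i → eqB (isNonzero (g i)) (memb (suc (toℕ i)) I)) (allFin (pred n))
          then 1ℤ else 0ℤ

-- coordinate p ∈ [1, m-1] of g ∈ Q_m(ν) (the default value is never used in range)
at : ∀ {ν} .{{_ : NonZero ν}} {m : ℕ} → Q ν m → ℕ → Fin ν
at {ν} g zero = zeroF ν
at {ν} {m} g (suc j) with j <? pred m
... | Relation.Nullary.yes h = g (fromℕ< h)
... | Relation.Nullary.no  _ = zeroF ν

-- The element of Q_{[1,k-1] ∪ [k+1,n-1]}(ν) ⊆ Q_n(ν) corresponding to
-- (a, b) ∈ Q_k(ν) × Q_{n-k}(ν) under id × ι_{[k+1,n-1]}: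
-- position p < k carries a_p, position k carries 0, position p > k carries b_{p-k}.
-- (For k = 0 this is b, for k = n it is a.)
glue : ∀ {ν} .{{_ : NonZero ν}} (n k : ℕ) → Q ν k → Q ν (n ∸ k) → Q ν n
glue {ν} n k a b i with suc (toℕ i) <? k | suc (toℕ i) ≟ k
... | Relation.Nullary.yes _ | _ = at {m = k} a (suc (toℕ i))
... | Relation.Nullary.no _  | Relation.Nullary.yes _ = zeroF ν
... | Relation.Nullary.no _  | Relation.Nullary.no _  = at {m = n ∸ k} b (suc (toℕ i) ∸ k)

-- Δ_k φ ∈ cf(Q_k(ν)) ⊗ cf(Q_{n-k}(ν)) ≅ cf(Q_k(ν) × Q_{n-k}(ν)).
-- For 1 ≤ k ≤ n-1 this is the restriction to Q_{[1,k-1]∪[k+1,n-1]} transported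
-- by id ⊗ (ι*)⁻¹; for k = 0 it is (a , b) ↦ 𝟙₀(a) φ(b), for k = n it is φ(a) 𝟙₀(b).
Δ : ∀ {ν} .{{_ : NonZero ν}} (n k : ℕ) → CF ν n → (Q ν k → Q ν (n ∸ k) → ℤ)
Δ n k φ a b = φ (glue n k a b)

_⊗_ : ∀ {ν m l} → CF ν m → CF ν l → (Q ν m → Q ν l → ℤ)
(f ⊗ g) a b = f a *ℤ g b
infixl 7 _⊗_

sumℤ : List ℤ → ℤ
sumℤ = foldr _+ℤ_ 0ℤ

-- degree-(k, n-k) component of  Σ_{α ⊙ β = γ} κ_{set α} ⊗ κ_{set β}
rhsComponent : ∀ {ν} (n k : ℕ) → List ℕ → Q ν k → Q ν (n ∸ k) → ℤ
rhsComponent n k γ a b =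
  sumℤ (map (λ p → _⊗_ {m = k} {l = n ∸ k} (κ k (setC (proj₁ p))) (κ (n ∸ k) (setC (proj₂ p))) a b)
            (filter (λ p → ≡-dec _≟_ (proj₁ p ⊙ proj₂ p) γ)
                    (cartesianProduct (compositions k) (compositions (n ∸ k)))))

{-# OPTIONS --safe #-}
-- The (k, n−k) component of ▲κ_{set γ} evaluates κ_{set γ} at the element G = (a, 0, b)
-- of Q_n, which is a in positions < k, 0 in position k and b shifted by k after it.
-- If γ = α ⊙ β with |α| = k, then set γ = set α ∪ (k + set β) and k ∉ set γ, so the
-- support condition on G splits into one for a and one for b:
-- κ_{set γ}(G) = κ_{set α}(a) κ_{set β}(b). Such a splitting exists exactly when
-- k ∉ set γ, and it is unique, so the sum on the right has this single term. If k ∈ set γ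
-- there is no splitting, and κ_{set γ}(G) = 0 because G vanishes at the descent k.
module Submission where

open import Defs
open import Data.Bool using (Bool; true; false; _∧_; _∨_; if_then_else_)
open import Data.Bool.Properties using (∨-identityʳ; ∨-assoc; ∨-conicalʳ; ∧-assoc; ∧-zeroʳ)
open import Data.Bool.ListAction using (all)
open import Data.Fin using (Fin; toℕ; fromℕ<)
import Data.Fin as Fin
open import Data.Fin.Properties using (toℕ-fromℕ<; fromℕ<-toℕ; toℕ<n; fromℕ<-cong)
open import Data.Integer using (ℤ; 0ℤ; 1ℤ) renaming (_*_ to _*ℤ_)
import Data.Integer.Properties as ℤ
open import Data.List
  using (List; []; _∷_; _++_; map; length; filter; concat; concatMap; upTo; tabulate; allFin; cartesianProduct)
open import Data.List.Properties using (∷-injective; map-++; map-∘; map-cong; map-id; filter-none)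
open import Data.List.Membership.Propositional using (_∈_)
open import Data.List.Membership.Propositional.Properties
open import Data.List.Relation.Binary.Disjoint.Propositional using (Disjoint)
open import Data.List.Relation.Unary.All as All using (All; []; _∷_)
import Data.List.Relation.Unary.All.Properties as All
open import Data.List.Relation.Unary.AllPairs as AllPairs using ([]; _∷_)
import Data.List.Relation.Unary.AllPairs.Properties as AllPairs
open import Data.List.Relation.Unary.Any using (here; there)
open import Data.List.Relation.Unary.Unique.Propositional using (Unique)
import Data.List.Relation.Unary.Unique.Propositional.Properties as Unique
open import Data.Nat
  using (ℕ; zero; suc; pred; _+_; _∸_; _<_; _≤_; _≡ᵇ_; _≟_; _<?_; z≤n; s≤s; z<s; s<s; NonZero;
         compare; less; equal; greater)
open import Data.Nat.ListAction using (sum)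
open import Data.Nat.Properties
open import Data.Product using (_×_; _,_; proj₁; proj₂; ∃₂)
open import Function using (_∘_)
open import Relation.Nullary using (yes; no; contradiction)
open import Relation.Nullary.Decidable using (dec-true; dec-false)
open import Relation.Unary using (Decidable)
open import Relation.Binary.PropositionalEquality

Pos : List ℕ → Set
Pos = All (0 <_)

-- Enumerating compositions

∈-listsOfLen⁻ : ∀ l m {xs} → xs ∈ listsOfLen l m → length xs ≡ l × Pos xs
∈-listsOfLen⁻ zero m (here refl) = refl , []
∈-listsOfLen⁻ (suc l) m xs∈
  with ys , xs∈ys , ys∈ ← ∈-concat⁻′ (map (λ x → map (x ∷_) (listsOfLen l m)) (map suc (upTo m))) xs∈
  with x , x∈ , refl ← ∈-map⁻ (λ x → map (x ∷_) (listsOfLen l m)) ys∈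
  with w , w∈ , refl ← ∈-map⁻ (x ∷_) xs∈ys
  with _ , _ , refl ← ∈-map⁻ suc x∈
  with len , pos ← ∈-listsOfLen⁻ l m w∈
  = cong suc len , s≤s z≤n ∷ pos

∈-listsOfLen⁺ : ∀ m {xs} → Pos xs → All (_≤ m) xs → xs ∈ listsOfLen (length xs) m
∈-listsOfLen⁺ m [] [] = here refl
∈-listsOfLen⁺ m {suc i ∷ xs} (_ ∷ pos) (i<m ∷ bnd) =
  ∈-concat⁺′ (∈-map⁺ (suc i ∷_) (∈-listsOfLen⁺ m pos bnd))
    (∈-map⁺ (λ x → map (x ∷_) (listsOfLen (length xs) m)) (∈-map⁺ suc (∈-upTo⁺ i<m)))

length≤sum : ∀ {xs} → Pos xs → length xs ≤ sum xs
length≤sum [] = z≤n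
length≤sum (p ∷ ps) = +-mono-≤ p (length≤sum ps)

All≤sum : ∀ xs → All (_≤ sum xs) xs
All≤sum [] = []
All≤sum (x ∷ xs) = m≤m+n x (sum xs) ∷ All.map (λ h → ≤-trans h (m≤n+m (sum xs) x)) (All≤sum xs)

∈-compositions⁺ : ∀ {m xs} → Pos xs → sum xs ≡ m → xs ∈ compositions m
∈-compositions⁺ {xs = xs} pos refl = ∈-filter⁺ (λ ys → sum ys ≟ sum xs)
  (∈-concat⁺′ (∈-listsOfLen⁺ (sum xs) pos (All≤sum xs))
    (∈-map⁺ (λ l → listsOfLen l (sum xs)) (∈-upTo⁺ (s≤s (length≤sum pos)))))
  refl

∈-compositions⁻ : ∀ {m xs} → xs ∈ compositions m → IsComposition m xs
∈-compositions⁻ {m} xs∈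
  with xs∈′ , sum≡ ← ∈-filter⁻ (λ xs → sum xs ≟ m) {xs = concatMap (λ l → listsOfLen l m) (upTo (suc m))} xs∈
  with ys , xs∈ys , ys∈ ← ∈-concat⁻′ (map (λ l → listsOfLen l m) (upTo (suc m))) xs∈′
  with l , _ , refl ← ∈-map⁻ (λ l → listsOfLen l m) {xs = upTo (suc m)} ys∈
  = proj₂ (∈-listsOfLen⁻ l m xs∈ys) , sum≡

listsOfLen-unique : ∀ l m → Unique (listsOfLen l m)
listsOfLen-unique zero m = [] ∷ []
listsOfLen-unique (suc l) m = Unique.concat⁺
  (All.map⁺ (All.map⁺ (All.universal (λ x → Unique.map⁺ (proj₂ ∘ ∷-injective) (listsOfLen-unique l m)) _)))
  (AllPairs.map⁺ (AllPairs.map⁺ (AllPairs.map heads-differ (Unique.upTo⁺ m))))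
  where
  heads-differ : ∀ {i j} → i ≢ j → Disjoint (map (suc i ∷_) (listsOfLen l m)) (map (suc j ∷_) (listsOfLen l m))
  heads-differ i≢j (p , q)
    with _ , _ , refl ← ∈-map⁻ _ p
    with _ , _ , e ← ∈-map⁻ _ q
    = i≢j (suc-injective (proj₁ (∷-injective e)))

compositions-unique : ∀ m → Unique (compositions m)
compositions-unique m = Unique.filter⁺ (λ xs → sum xs ≟ m) {xs = concat blocks}
  (Unique.concat⁺ blocks-unique blocks-disjoint)
  where
  blocks : List (List (List ℕ))
  blocks = map (λ l → listsOfLen l m) (upTo (suc m))
  blocks-unique : All Unique blocks
  blocks-unique = All.map⁺ (All.universal (λ l → listsOfLen-unique l m) (upTo (suc m)))
  lengths-differ : ∀ {l l′} → l ≢ l′ → Disjoint (listsOfLen l m) (listsOfLen l′ m)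
  lengths-differ {l} {l′} l≢l′ (p , q) =
    l≢l′ (trans (sym (proj₁ (∈-listsOfLen⁻ l m p))) (proj₁ (∈-listsOfLen⁻ l′ m q)))
  blocks-disjoint : AllPairs.AllPairs Disjoint blocks
  blocks-disjoint = AllPairs.map⁺ (AllPairs.map lengths-differ (Unique.upTo⁺ (suc m)))

-- Near-concatenation and descent sets

⊙-pos : ∀ {α β} → Pos α → Pos β → Pos (α ⊙ β)
⊙-pos [] pβ = pβ
⊙-pos {_ ∷ []} {[]} pα [] = pα
⊙-pos {a ∷ []} {b ∷ _} (pa ∷ []) (_ ∷ pβ) = <-≤-trans pa (m≤m+n a b) ∷ pβ
⊙-pos {_ ∷ _ ∷ _} (pa ∷ pα) pβ = pa ∷ ⊙-pos pα pβ

sum-⊙ : ∀ α β → sum (α ⊙ β) ≡ sum α + sum β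
sum-⊙ [] β = refl
sum-⊙ (a ∷ []) [] = sym (+-identityʳ (a + 0))
sum-⊙ (a ∷ []) (b ∷ β) = trans (+-assoc a b (sum β)) (cong (_+ (b + sum β)) (sym (+-identityʳ a)))
sum-⊙ (a ∷ a′ ∷ α) β = trans (cong (a +_) (sum-⊙ (a′ ∷ α) β)) (sym (+-assoc a _ _))

map-+-map-+ : ∀ a b L → map (a +_) (map (b +_) L) ≡ map ((a + b) +_) L
map-+-map-+ a b L = trans (sym (map-∘ L)) (map-cong (λ x → sym (+-assoc a b x)) L)

setC-+ : ∀ a b β → setC ((a + b) ∷ β) ≡ map (a +_) (setC (b ∷ β))
setC-+ a b [] = refl
setC-+ a b (c ∷ β) = cong ((a + b) ∷_) (sym (map-+-map-+ a b (setC (c ∷ β))))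

setC-⊙ : ∀ α β → setC (α ⊙ β) ≡ setC α ++ map (sum α +_) (setC β)
setC-⊙ [] β = sym (map-id (setC β))
setC-⊙ (a ∷ []) [] = refl
setC-⊙ (a ∷ []) (b ∷ β) =
  trans (setC-+ a b β) (cong (λ x → map (x +_) (setC (b ∷ β))) (sym (+-identityʳ a)))
setC-⊙ (a ∷ a′ ∷ α) β = begin
    setC (a ∷ ((a′ ∷ α) ⊙ β))
  ≡⟨ setC-cons (⊙-nonempty a′ α β) ⟩
    a ∷ map (a +_) (setC ((a′ ∷ α) ⊙ β))
  ≡⟨ cong (λ L → a ∷ map (a +_) L) (setC-⊙ (a′ ∷ α) β) ⟩
    a ∷ map (a +_) (setC (a′ ∷ α) ++ map (sum (a′ ∷ α) +_) (setC β))
  ≡⟨ cong (a ∷_) (map-++ (a +_) (setC (a′ ∷ α)) _) ⟩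
    a ∷ (map (a +_) (setC (a′ ∷ α)) ++ map (a +_) (map (sum (a′ ∷ α) +_) (setC β)))
  ≡⟨ cong (λ L → a ∷ (map (a +_) (setC (a′ ∷ α)) ++ L)) (map-+-map-+ a (sum (a′ ∷ α)) (setC β)) ⟩
    a ∷ (map (a +_) (setC (a′ ∷ α)) ++ map ((a + sum (a′ ∷ α)) +_) (setC β))
  ∎
  where
  open ≡-Reasoning
  ⊙-nonempty : ∀ a α β → ∃₂ λ x xs → (a ∷ α) ⊙ β ≡ x ∷ xs
  ⊙-nonempty a [] [] = _ , _ , refl
  ⊙-nonempty a [] (b ∷ β) = _ , _ , refl
  ⊙-nonempty a (_ ∷ _) β = _ , _ , refl
  setC-cons : ∀ {a L} → (∃₂ λ x xs → L ≡ x ∷ xs) → setC (a ∷ L) ≡ a ∷ map (a +_) (setC L)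
  setC-cons (_ , _ , refl) = refl

setC-pos : ∀ {α} → Pos α → All (0 <_) (setC α)
setC-pos [] = []
setC-pos (_ ∷ []) = []
setC-pos {a ∷ _ ∷ _} (pa ∷ pα) = pa ∷ All.map⁺ (All.map (λ {x} _ → <-≤-trans pa (m≤m+n a x)) (setC-pos pα))

setC-< : ∀ {α} → Pos α → All (_< sum α) (setC α)
setC-< [] = []
setC-< (_ ∷ []) = []
setC-< {a ∷ b ∷ α} (_ ∷ pb ∷ pα) =
  m<m+n a (<-≤-trans pb (m≤m+n b (sum α))) ∷ All.map⁺ (All.map (+-monoʳ-< a) (setC-< (pb ∷ pα)))

memb-++ : ∀ p xs ys → memb p (xs ++ ys) ≡ memb p xs ∨ memb p ys
memb-++ p [] ys = refl
memb-++ p (x ∷ xs) ys = trans (cong ((p ≡ᵇ x) ∨_) (memb-++ p xs ys)) (sym (∨-assoc (p ≡ᵇ x) _ _))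

memb-+-map : ∀ k q L → memb (k + q) (map (k +_) L) ≡ memb q L
memb-+-map zero q L = cong (memb q) (map-id L)
memb-+-map (suc k) q [] = refl
memb-+-map (suc k) q (x ∷ L) = cong₂ _∨_ (+-≡ᵇ k) (memb-+-map (suc k) q L)
  where
  +-≡ᵇ : ∀ k → (k + q ≡ᵇ k + x) ≡ (q ≡ᵇ x)
  +-≡ᵇ zero = refl
  +-≡ᵇ (suc k) = +-≡ᵇ k

memb-head : ∀ p L → memb p (p ∷ L) ≡ true
memb-head p L = cong (_∨ memb p L) (dec-true (p ≟ p) refl)

memb-∉ : ∀ {p L} → All (p ≢_) L → memb p L ≡ false
memb-∉ [] = refl
memb-∉ {p} {x ∷ _} (p≢x ∷ ps) = cong₂ _∨_ (dec-false (p ≟ x) p≢x) (memb-∉ ps)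

memb-0-setC : ∀ {α} → Pos α → memb 0 (setC α) ≡ false
memb-0-setC pα = memb-∉ (All.map (λ 0<x 0≡x → <-irrefl 0≡x 0<x) (setC-pos pα))

memb-setC-< : ∀ {p α} → Pos α → memb p (setC α) ≡ true → p < sum α
memb-setC-< {p} {α} pα p∈ with p <? sum α
... | yes p<sum = p<sum
... | no p≮sum = contradiction (trans (sym p∈) (memb-∉ (All.map differs (setC-< pα)))) λ ()
  where
  differs : ∀ {x} → x < sum α → p ≢ x
  differs x<sum refl = p≮sum x<sum

memb-⊙-< : ∀ {p} α β → p < sum α → memb p (setC (α ⊙ β)) ≡ memb p (setC α)
memb-⊙-< {p} α β p<sum = begin
    memb p (setC (α ⊙ β))
  ≡⟨ cong (memb p) (setC-⊙ α β) ⟩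
    memb p (setC α ++ map (sum α +_) (setC β))
  ≡⟨ memb-++ p (setC α) _ ⟩
    memb p (setC α) ∨ memb p (map (sum α +_) (setC β))
  ≡⟨ cong (memb p (setC α) ∨_) (memb-∉ (All.map⁺ (All.universal below-shift (setC β)))) ⟩
    memb p (setC α) ∨ false
  ≡⟨ ∨-identityʳ _ ⟩
    memb p (setC α)
  ∎
  where
  open ≡-Reasoning
  below-shift : ∀ x → p ≢ sum α + x
  below-shift x p≡ = <-irrefl p≡ (<-≤-trans p<sum (m≤m+n (sum α) x))

memb-⊙-+ : ∀ {α} β q → Pos α → memb (sum α + q) (setC (α ⊙ β)) ≡ memb q (setC β)
memb-⊙-+ {α} β q pα = begin
    memb (sum α + q) (setC (α ⊙ β))
  ≡⟨ cong (memb (sum α + q)) (setC-⊙ α β) ⟩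
    memb (sum α + q) (setC α ++ map (sum α +_) (setC β))
  ≡⟨ memb-++ (sum α + q) (setC α) _ ⟩
    memb (sum α + q) (setC α) ∨ memb (sum α + q) (map (sum α +_) (setC β))
  ≡⟨ cong₂ _∨_ (memb-∉ (All.map above-setC (setC-< pα))) (memb-+-map (sum α) q (setC β)) ⟩
    memb q (setC β)
  ∎
  where
  open ≡-Reasoning
  above-setC : ∀ {x} → x < sum α → sum α + q ≢ x
  above-setC x<sum ≡x = <-irrefl (sym ≡x) (<-≤-trans x<sum (m≤m+n (sum α) q))

memb-⊙-sum : ∀ {α β} → Pos α → Pos β → memb (sum α) (setC (α ⊙ β)) ≡ false
memb-⊙-sum {α} {β} pα pβ = begin
    memb (sum α) (setC (α ⊙ β))
  ≡⟨ cong (λ p → memb p (setC (α ⊙ β))) (sym (+-identityʳ (sum α))) ⟩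
    memb (sum α + 0) (setC (α ⊙ β))
  ≡⟨ memb-⊙-+ β 0 pα ⟩
    memb 0 (setC β)
  ≡⟨ memb-0-setC pβ ⟩
    false
  ∎
  where open ≡-Reasoning

-- Splitting a composition

[a]⊙-injective : ∀ {a β β′} → Pos β → Pos β′ → (a ∷ []) ⊙ β ≡ (a ∷ []) ⊙ β′ → β ≡ β′
[a]⊙-injective {β = []} {[]} _ _ _ = refl
[a]⊙-injective {a} {[]} {_ ∷ _} _ (s≤s _ ∷ _) e = contradiction (sym (proj₁ (∷-injective e))) (m+1+n≢m a)
[a]⊙-injective {a} {_ ∷ _} {[]} (s≤s _ ∷ _) _ e = contradiction (proj₁ (∷-injective e)) (m+1+n≢m a)
[a]⊙-injective {a} {b ∷ _} {b′ ∷ _} _ _ e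
  with a+b≡a+b′ , rest ← ∷-injective e = cong₂ _∷_ (+-cancelˡ-≡ a b b′ a+b≡a+b′) rest

[a]⊙-head : ∀ {a a′ β xs} → a′ < a → (a ∷ []) ⊙ β ≢ a′ ∷ xs
[a]⊙-head {β = []} a′<a e = <-irrefl (sym (proj₁ (∷-injective e))) a′<a
[a]⊙-head {a} {β = b ∷ _} a′<a e = <⇒≱ a′<a (subst (a ≤_) (proj₁ (∷-injective e)) (m≤m+n a b))

head<sum-[_] : ∀ x {a a₂ α} → Pos (a₂ ∷ α) → sum (a ∷ a₂ ∷ α) ≡ sum (x ∷ []) → a < x
head<sum-[ x ] {a} {a₂} {α} (pa₂ ∷ _) s =
  subst (a <_) (trans s (+-identityʳ x)) (m<m+n a (<-≤-trans pa₂ (m≤m+n a₂ (sum α))))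

⊙-cancel : ∀ {α β α′ β′} → Pos α → Pos β → Pos α′ → Pos β′ →
           sum α ≡ sum α′ → α ⊙ β ≡ α′ ⊙ β′ → α ≡ α′ × β ≡ β′
⊙-cancel {[]} {_} {[]} _ _ _ _ _ e = refl , e
⊙-cancel {[]} {_} {a′ ∷ α′} _ _ (pa′ ∷ _) _ s _ =
  contradiction s (<⇒≢ (<-≤-trans pa′ (m≤m+n a′ (sum α′))))
⊙-cancel {a ∷ α} {_} {[]} (pa ∷ _) _ _ _ s _ =
  contradiction (sym s) (<⇒≢ (<-≤-trans pa (m≤m+n a (sum α))))
⊙-cancel {a ∷ []} {_} {a′ ∷ []} _ pβ _ pβ′ s e
  with refl ← +-cancelʳ-≡ 0 a a′ s = refl , [a]⊙-injective pβ pβ′ e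
⊙-cancel {a ∷ []} {β} {_ ∷ _ ∷ _} _ _ (_ ∷ pα′) _ s e =
  contradiction e ([a]⊙-head {β = β} (head<sum-[ a ] pα′ (sym s)))
⊙-cancel {_ ∷ _ ∷ _} {_} {a′ ∷ []} {β′} (_ ∷ pα) _ _ _ s e =
  contradiction (sym e) ([a]⊙-head {β = β′} (head<sum-[ a′ ] pα s))
⊙-cancel {a ∷ a₂ ∷ α} {_} {a′ ∷ a₂′ ∷ α′} (_ ∷ pα) pβ (_ ∷ pα′) pβ′ s e
  with refl , e′ ← ∷-injective e
  with α≡ , β≡ ← ⊙-cancel pα pβ pα′ pβ′ (+-cancelˡ-≡ a _ _ s) e′
  = cong (a ∷_) α≡ , β≡

record Split (γ : List ℕ) (k : ℕ) : Set where
  constructor split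
  field
    left right : List ℕ
    left-pos   : Pos left
    right-pos  : Pos right
    left-sum   : sum left ≡ k
    glues      : left ⊙ right ≡ γ

-- Walk along γ = c ∷ γ′: cut inside c if k < c, stop at c = k (only possible at the end,
-- since k is not a descent), and otherwise keep c and split γ′ at k − c.
split-exists : ∀ {γ k} → Pos γ → k ≤ sum γ → memb k (setC γ) ≡ false → Split γ k
split-exists {γ} {zero} pγ _ _ = split [] γ [] pγ refl refl
split-exists {[]} {suc k} _ () _
split-exists {c ∷ γ} {suc k} (_ ∷ pγ) _ _ with compare (suc k) c
... | less _ d = split (suc k ∷ []) (suc d ∷ γ) (s≤s z≤n ∷ []) (s≤s z≤n ∷ pγ)
                       (+-identityʳ (suc k)) (cong (_∷ γ) (+-suc (suc k) d))
split-exists {_ ∷ []} {suc k} (pc ∷ _) _ _ | equal _ =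
  split (suc k ∷ []) [] (pc ∷ []) [] (+-identityʳ (suc k)) refl
split-exists {_ ∷ e ∷ γ} {suc k} _ _ k∉ | equal _ =
  contradiction (trans (sym (memb-head (suc k) (map (suc k +_) (setC (e ∷ γ))))) k∉) λ ()
split-exists {_ ∷ []} {suc k} _ k≤c _ | greater c d =
  contradiction (subst (suc (c + d) ≤_) (+-identityʳ c) k≤c) (<⇒≱ (s≤s (m≤m+n c d)))
split-exists {_ ∷ e ∷ γ} {suc k} (pc ∷ pγ) k≤sum k∉ | greater c d
  with split-exists {k = suc d} pγ rest≤ rest∉
  where
  rest≤ : suc d ≤ sum (e ∷ γ)
  rest≤ = +-cancelˡ-≤ c _ _ (subst (_≤ c + sum (e ∷ γ)) (sym (+-suc c d)) k≤sum)
  rest∉ : memb (suc d) (setC (e ∷ γ)) ≡ false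
  rest∉ = trans (sym (memb-+-map c (suc d) (setC (e ∷ γ))))
                (∨-conicalʳ _ _ (subst (λ x → memb x (setC (c ∷ e ∷ γ)) ≡ false) (sym (+-suc c d)) k∉))
... | split (a₁ ∷ α) β pα pβ sα glues =
  split (c ∷ a₁ ∷ α) β (pc ∷ pα) pβ (trans (cong (c +_) sα) (+-suc c d)) (cong (c ∷_) glues)

-- The indicator κ as a conjunction over positions

allBelow : (ℕ → Bool) → ℕ → Bool
allBelow f zero = true
allBelow f (suc m) = f 0 ∧ allBelow (f ∘ suc) m

allBelow-cong : ∀ {f g} m → (∀ {j} → j < m → f j ≡ g j) → allBelow f m ≡ allBelow g m
allBelow-cong zero _ = refl
allBelow-cong (suc m) f≡g = cong₂ _∧_ (f≡g z<s) (allBelow-cong m (f≡g ∘ s<s))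

allBelow-+ : ∀ f m n → allBelow f (m + n) ≡ allBelow f m ∧ allBelow (f ∘ (m +_)) n
allBelow-+ f zero n = refl
allBelow-+ f (suc m) n = trans (cong (f 0 ∧_) (allBelow-+ (f ∘ suc) m n)) (sym (∧-assoc (f 0) _ _))

allBelow-false : ∀ {f j m} → j < m → f j ≡ false → allBelow f m ≡ false
allBelow-false {f} {zero} {suc m} _ fj = cong (_∧ allBelow (f ∘ suc) m) fj
allBelow-false {f} {suc j} {suc m} (s≤s j<m) fj =
  trans (cong (f 0 ∧_) (allBelow-false {f ∘ suc} j<m fj)) (∧-zeroʳ (f 0))

all-tabulate : ∀ {A : Set} m (h : Fin m → A) (P : A → Bool) (f : ℕ → Bool) →
               (∀ i → P (h i) ≡ f (toℕ i)) → all P (tabulate h) ≡ allBelow f m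
all-tabulate zero h P f Ph≡f = refl
all-tabulate (suc m) h P f Ph≡f =
  cong₂ _∧_ (Ph≡f Fin.zero) (all-tabulate m (h ∘ Fin.suc) P (f ∘ suc) (Ph≡f ∘ Fin.suc))

indicator : Bool → ℤ
indicator b = if b then 1ℤ else 0ℤ

indicator-∧ : ∀ x y → indicator (x ∧ y) ≡ indicator x *ℤ indicator y
indicator-∧ true y = sym (ℤ.*-identityˡ (indicator y))
indicator-∧ false y = sym (ℤ.*-zeroˡ (indicator y))

isNonzero-zeroF : ∀ ν .{{_ : NonZero ν}} → isNonzero (zeroF ν) ≡ false
isNonzero-zeroF (suc _) = refl

module _ {ν : ℕ} .{{_ : NonZero ν}} where

  at-fromℕ< : ∀ {m} (g : Q ν m) {q} (h : q < pred m) → at {m = m} g (suc q) ≡ g (fromℕ< h)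
  at-fromℕ< {m} g {q} h with q <? pred m
  ... | yes h′ = cong g (fromℕ<-cong q q refl h′ h)
  ... | no h̸ = contradiction h h̸

  at-≥ : ∀ {m} (g : Q ν m) {p} → m ≤ p → at {m = m} g p ≡ zeroF ν
  at-≥ g {zero} _ = refl
  at-≥ {m} g {suc q} m≤p with q <? pred m
  ... | yes h = contradiction (pred-mono-≤ m≤p) (<⇒≱ h)
  ... | no _ = refl

  agreesAt : ∀ m → Q ν m → List ℕ → ℕ → Bool
  agreesAt m g I p = eqB (isNonzero (at {m = m} g p)) (memb p I)

  -- allBelow also checks position 0, where g and I agree trivially (at g 0 = 0 and 0 ∉ I).
  κ-allBelow : ∀ m I (g : Q ν m) → memb 0 I ≡ false → κ m I g ≡ indicator (allBelow (agreesAt m g I) m)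
  κ-allBelow zero I g _ = refl
  κ-allBelow (suc m) I g 0∉I = cong indicator (begin
      all (λ i → eqB (isNonzero (g i)) (memb (suc (toℕ i)) I)) (allFin m)
    ≡⟨ all-tabulate m (λ i → i) _ (agreesAt (suc m) g I ∘ suc) agrees-suc ⟩
      allBelow (agreesAt (suc m) g I ∘ suc) m
    ≡⟨ sym (cong₂ (λ x y → eqB x y ∧ allBelow (agreesAt (suc m) g I ∘ suc) m) (isNonzero-zeroF ν) 0∉I) ⟩
      allBelow (agreesAt (suc m) g I) (suc m)
    ∎)
    where
    open ≡-Reasoning
    agrees-suc : ∀ i → eqB (isNonzero (g i)) (memb (suc (toℕ i)) I) ≡ agreesAt (suc m) g I (suc (toℕ i))
    agrees-suc i = cong (λ x → eqB (isNonzero x) (memb (suc (toℕ i)) I))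
                        (sym (trans (at-fromℕ< {suc m} g (toℕ<n i)) (cong g (fromℕ<-toℕ i (toℕ<n i)))))

  module _ {n k : ℕ} (a : Q ν k) (b : Q ν (n ∸ k)) where

    glue-< : ∀ i {q} → toℕ i ≡ q → suc q < k → glue n k a b i ≡ at {m = k} a (suc q)
    glue-< i refl q<k with suc (toℕ i) <? k | suc (toℕ i) ≟ k
    ... | yes _  | _ = refl
    ... | no q≮k | _ = contradiction q<k q≮k

    glue-≥ : ∀ i {q} → toℕ i ≡ q → k ≤ suc q → glue n k a b i ≡ at {m = n ∸ k} b (suc q ∸ k)
    glue-≥ i refl k≤q with suc (toℕ i) <? k | suc (toℕ i) ≟ k
    ... | yes q<k | _       = contradiction k≤q (<⇒≱ q<k)
    ... | no _    | yes q≡k = cong (at {m = n ∸ k} b) (sym (trans (cong (_∸ k) q≡k) (n∸n≡0 k)))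
    ... | no _    | no _    = refl

    at-glue-< : k ≤ n → ∀ {p} → p < k → at {m = n} (glue n k a b) p ≡ at {m = k} a p
    at-glue-< _ {zero} _ = refl
    at-glue-< k≤n {suc q} q<k =
      trans (at-fromℕ< {n} (glue n k a b) q<n) (glue-< (fromℕ< q<n) (toℕ-fromℕ< q<n) q<k)
      where
      q<n : q < pred n
      q<n = pred-mono-≤ (<-≤-trans q<k k≤n)

    at-glue-≥ : ∀ {p} → k ≤ p → at {m = n} (glue n k a b) p ≡ at {m = n ∸ k} b (p ∸ k)
    at-glue-≥ {zero} _ = cong (at {m = n ∸ k} b) (sym (0∸n≡0 k))
    at-glue-≥ {suc q} k≤p with suc q <? n
    ... | yes 1+q<n = trans (at-fromℕ< {n} (glue n k a b) q<n) (glue-≥ (fromℕ< q<n) (toℕ-fromℕ< q<n) k≤p)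
      where
      q<n : q < pred n
      q<n = pred-mono-≤ 1+q<n
    ... | no q≮n = trans (at-≥ (glue n k a b) (≮⇒≥ q≮n)) (sym (at-≥ b (∸-monoˡ-≤ k (≮⇒≥ q≮n))))

  Δκ-split : ∀ {n k γ} (s : Split γ k) → k ≤ n → (a : Q ν k) (b : Q ν (n ∸ k)) →
             Δ n k (κ n (setC γ)) a b ≡ κ k (setC (Split.left s)) a *ℤ κ (n ∸ k) (setC (Split.right s)) b
  Δκ-split {n} (split α β pα pβ refl refl) k≤n a b = begin
      κ n (setC (α ⊙ β)) G
    ≡⟨ κ-allBelow n (setC (α ⊙ β)) G (memb-0-setC (⊙-pos pα pβ)) ⟩
      indicator (allBelow F n)
    ≡⟨ cong (indicator ∘ allBelow F) (sym (m+[n∸m]≡n k≤n)) ⟩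
      indicator (allBelow F (k + (n ∸ k)))
    ≡⟨ cong indicator (allBelow-+ F k (n ∸ k)) ⟩
      indicator (allBelow F k ∧ allBelow (F ∘ (k +_)) (n ∸ k))
    ≡⟨ cong₂ (λ x y → indicator (x ∧ y)) (allBelow-cong k F≡A)
                                          (allBelow-cong (n ∸ k) (λ {j} _ → F+≡B j)) ⟩
      indicator (allBelow A k ∧ allBelow B (n ∸ k))
    ≡⟨ indicator-∧ (allBelow A k) (allBelow B (n ∸ k)) ⟩
      indicator (allBelow A k) *ℤ indicator (allBelow B (n ∸ k))
    ≡⟨ sym (cong₂ _*ℤ_ (κ-allBelow k (setC α) a (memb-0-setC pα))
                       (κ-allBelow (n ∸ k) (setC β) b (memb-0-setC pβ))) ⟩
      κ k (setC α) a *ℤ κ (n ∸ k) (setC β) b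
    ∎
    where
    open ≡-Reasoning
    k = sum α
    G = glue n k a b
    F = agreesAt n G (setC (α ⊙ β))
    A = agreesAt k a (setC α)
    B = agreesAt (n ∸ k) b (setC β)
    F≡A : ∀ {p} → p < k → F p ≡ A p
    F≡A p<k = cong₂ eqB (cong isNonzero (at-glue-< a b k≤n p<k)) (memb-⊙-< α β p<k)
    F+≡B : ∀ j → F (k + j) ≡ B j
    F+≡B j = cong₂ eqB (cong isNonzero (trans (at-glue-≥ a b (m≤m+n k j))
                                              (cong (at {m = n ∸ k} b) (m+n∸m≡n k j))))
                       (memb-⊙-+ β j pα)

  Δκ-descent : ∀ {n k γ} → Pos γ → k < n → memb k (setC γ) ≡ true → (a : Q ν k) (b : Q ν (n ∸ k)) →
               Δ n k (κ n (setC γ)) a b ≡ 0ℤ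
  Δκ-descent {n} {k} {γ} pγ k<n k∈ a b =
    trans (κ-allBelow n (setC γ) (glue n k a b) (memb-0-setC pγ)) (cong indicator (allBelow-false k<n disagrees))
    where
    glue-zero : isNonzero (at {m = n} (glue n k a b) k) ≡ false
    glue-zero = trans (cong isNonzero (trans (at-glue-≥ {n} {k} a b ≤-refl) (cong (at {m = n ∸ k} b) (n∸n≡0 k))))
                      (isNonzero-zeroF ν)
    disagrees : agreesAt n (glue n k a b) (setC γ) k ≡ false
    disagrees = cong₂ eqB glue-zero k∈

-- Sums over splittings

filter-≡-singleton : ∀ {A : Set} {P : A → Set} (P? : Decidable P) {xs} x → Unique xs → x ∈ xs → P x →
               (∀ {y} → y ∈ xs → P y → y ≡ x) → filter P? xs ≡ x ∷ []
filter-≡-singleton P? x xs-unique x∈ Px only-x =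
  sole-element (Unique.filter⁺ P? xs-unique) (∈-filter⁺ P? x∈ Px)
    (λ y∈ → let y∈xs , Py = ∈-filter⁻ P? y∈ in only-x y∈xs Py)
  where
  sole-element : ∀ {ys} → Unique ys → x ∈ ys → (∀ {y} → y ∈ ys → y ≡ x) → ys ≡ x ∷ []
  sole-element {_ ∷ []} _ _ all≡x = cong (_∷ []) (all≡x (here refl))
  sole-element {_ ∷ _ ∷ _} ((y≢z ∷ _) ∷ _) _ all≡x =
    contradiction (trans (all≡x (here refl)) (sym (all≡x (there (here refl))))) y≢z

module _ {ν : ℕ} (n k : ℕ) (γ : List ℕ) (a : Q ν k) (b : Q ν (n ∸ k)) where

  private
    Pairs : List (List ℕ × List ℕ)
    Pairs = cartesianProduct (compositions k) (compositions (n ∸ k))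

    ∈-Pairs⁻ : ∀ {α β} → (α , β) ∈ Pairs → IsComposition k α × IsComposition (n ∸ k) β
    ∈-Pairs⁻ αβ∈ = let α∈ , β∈ = ∈-cartesianProduct⁻ (compositions k) (compositions (n ∸ k)) αβ∈
                   in ∈-compositions⁻ α∈ , ∈-compositions⁻ β∈

  rhsComponent-descent : memb k (setC γ) ≡ true → rhsComponent n k γ a b ≡ 0ℤ
  rhsComponent-descent k∈ =
    cong (λ ps → sumℤ (map _ ps)) (filter-none _ (All.tabulate no-split))
    where
    no-split : ∀ {αβ} → αβ ∈ Pairs → proj₁ αβ ⊙ proj₂ αβ ≢ γ
    no-split αβ∈ refl with (pα , refl) , (pβ , _) ← ∈-Pairs⁻ αβ∈ =
      contradiction (trans (sym k∈) (memb-⊙-sum pα pβ)) λ ()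

  rhsComponent-split : sum γ ≡ n → (s : Split γ k) →
    rhsComponent n k γ a b ≡ κ k (setC (Split.left s)) a *ℤ κ (n ∸ k) (setC (Split.right s)) b
  rhsComponent-split sγ (split α β pα pβ sα glues) =
    trans (cong (λ ps → sumℤ (map term ps)) (filter-≡-singleton _ (α , β) Pairs-unique αβ∈ glues only-αβ))
          (ℤ.+-identityʳ _)
    where
    term : List ℕ × List ℕ → ℤ
    term (α′ , β′) = κ k (setC α′) a *ℤ κ (n ∸ k) (setC β′) b
    Pairs-unique : Unique Pairs
    Pairs-unique = Unique.cartesianProduct⁺ (compositions-unique k) (compositions-unique (n ∸ k))
    k+sumβ≡n : k + sum β ≡ n
    k+sumβ≡n = begin
        k + sum β
      ≡⟨ cong (_+ sum β) (sym sα) ⟩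
        sum α + sum β
      ≡⟨ sym (sum-⊙ α β) ⟩
        sum (α ⊙ β)
      ≡⟨ cong sum glues ⟩
        sum γ
      ≡⟨ sγ ⟩
        n
      ∎
      where open ≡-Reasoning
    αβ∈ : (α , β) ∈ Pairs
    αβ∈ = ∈-cartesianProduct⁺ (∈-compositions⁺ pα sα)
            (∈-compositions⁺ pβ (trans (sym (m+n∸m≡n k (sum β))) (cong (_∸ k) k+sumβ≡n)))
    only-αβ : ∀ {αβ′} → αβ′ ∈ Pairs → proj₁ αβ′ ⊙ proj₂ αβ′ ≡ γ → αβ′ ≡ (α , β)
    only-αβ αβ′∈ glues′
      with (pα′ , sα′) , (pβ′ , _) ← ∈-Pairs⁻ αβ′∈
      with α≡ , β≡ ← ⊙-cancel pα′ pβ′ pα pβ (trans sα′ (sym sα)) (trans glues′ (sym glues))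
      = cong₂ _,_ α≡ β≡

proposition3p17 : (ν : ℕ) → .{{_ : NonZero ν}} → 1 < ν →
    (n : ℕ) (γ : List ℕ) → IsComposition n γ →
    (k : ℕ) → k ≤ n → (a : Q ν k) (b : Q ν (n Data.Nat.∸ k)) →
    Δ n k (κ n (setC γ)) a b ≡ rhsComponent n k γ a b
proposition3p17 ν _ n γ (pγ , sγ) k k≤n a b with memb k (setC γ) in k∈?
... | true = trans (Δκ-descent pγ (subst (k <_) sγ (memb-setC-< pγ k∈?)) k∈? a b)
                   (sym (rhsComponent-descent n k γ a b k∈?))
... | false with s ← split-exists pγ (subst (k ≤_) (sym sγ) k≤n) k∈? =
  trans (Δκ-split s k≤n a b) (sym (rhsComponent-split n k γ a b sγ s))
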